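{- Let $\mathcal{A}$ be an MV-chain and $\mathbf{M}$ a finite $\mathcal{A}$-model. Let $\mathbf{M}'$ be the finite $\mathbf{2}$-model with the same universe such that for every atomic formula $\psi$ and evaluation $v$, $\|\psi\|^{\mathbf{2}}_{\mathbf{M}',v}=1$ if $\|\psi\|^{\mathcal{A}}_{\mathbf{M},v}\in A^+$ and $\|\psi\|^{\mathbf{2}}_{\mathbf{M}',v}=0$ otherwise. Then for every classical formula $\varphi$ and evaluation $v$, if $\|\mathrm{PREDEF}_\varphi\|^{\mathcal{A}}_{\mathbf{M},v}>0$, then $\|\varphi\|^{\mathcal{A}}_{\mathbf{M},v}\in A^+$ iff $\|\varphi\|^{\mathbf{2}}_{\mathbf{M}',v}=1$.
   Context: An MV-chain is a totally ordered MTL-algebra $\langle A,*,\Rightarrow,\sqcap,\sqcup,0,1\rangle$ (bounded lattice, commutative monoid $\langle A,*,1\rangle$, $z*x\le y$ iff $z\le x\Rightarrow y$) satisfying $x\sqcap y=x*(x\Rightarrow y)$ and $\sim\sim x=x$, where $\sim x:=x\Rightarrow 0$. $A^+:=\{x\in A: x>\sim x\}$. $\mathbf{2}$ is the two-element Boolean algebra. First-order formulas are over a countable set of predicate symbols (no constants, functions, equality), with connectives $\&,\to,\land,\bot$, derived $\neg\varphi:=\varphi\to\bot$, $\vee$, $\varphi\leftrightarrow\psi:=(\varphi\to\psi)\land(\psi\to\varphi)$, quantifiers $\forall,\exists$. A formula is classical if it contains only $\land,\vee,\neg$ as connectives and only $\forall$ as quantifier. For atomic $P(\vec x)$, $\mathrm{PREDEF}_P:=(\forall\vec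 x)\neg(P(\vec x)\leftrightarrow\neg P(\vec x))$; $\mathrm{PREDEF}_\varphi$ is the $\land$-conjunction of $\mathrm{PREDEF}_P$ over atomic formulas in $\varphi$. A finite $\mathcal{B}$-model (for a chain $\mathcal{B}$) is $\langle M,\{r_P\}\rangle$ with $M$ finite nonempty and $r_P:M^k\to B$; values use the operations of $\mathcal{B}$, $\forall$ as $\min$, $\exists$ as $\max$. -}

module Defs where

open import Data.Nat using (ℕ; zero; suc; _≡ᵇ_)
open import Data.Fin using (Fin; zero; suc)
open import Data.Vec using (Vec; []; _∷_)
import Data.Vec as Vec
open import Data.List using (List; []; _∷_; _++_)
import Data.List as List
open import Data.Bool using (Bool; true; false; not; if_then_else_)
import Data.Bool as B
open import Data.Product using (_×_; Σ; _,_)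
open import Data.Sum using (_⊎_)
open import Relation.Nullary using (¬_)
open import Relation.Binary.PropositionalEquality using (_≡_)

-- Operations of a (chain) algebra ⟨A,*,⇒,⊓,⊔,0,1⟩ : all that semantics needs

record ChainOps : Set₁ where
  field
    Carrier : Set
    _*_ _⇛_ _⊓_ _⊔_ : Carrier → Carrier → Carrier
    0# 1# : Carrier

record MVChain : Set₁ where
  infix 4 _≤_
  field
    Carrier : Set
    _*_ _⇛_ _⊓_ _⊔_ : Carrier → Carrier → Carrier
    0# 1# : Carrier
    _≤_ : Carrier → Carrier → Set
    ≤-refl    : ∀ x → x ≤ x
    ≤-antisym : ∀ {x y} → x ≤ y → y ≤ x → x ≡ y
    ≤-trans   : ∀ {x y z} → x ≤ y → y ≤ z → x ≤ z
    ≤-total   : ∀ x y → x ≤ y ⊎ y ≤ x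
    ⊓-lowerˡ : ∀ x y → (x ⊓ y) ≤ x
    ⊓-lowerʳ : ∀ x y → (x ⊓ y) ≤ y
    ⊓-glb    : ∀ {x y z} → z ≤ x → z ≤ y → z ≤ (x ⊓ y)
    ⊔-upperˡ : ∀ x y → x ≤ (x ⊔ y)
    ⊔-upperʳ : ∀ x y → y ≤ (x ⊔ y)
    ⊔-lub    : ∀ {x y z} → x ≤ z → y ≤ z → (x ⊔ y) ≤ z
    0-least  : ∀ x → 0# ≤ x
    1-great  : ∀ x → x ≤ 1#
    *-assoc     : ∀ x y z → ((x * y) * z) ≡ (x * (y * z))
    *-comm      : ∀ x y → (x * y) ≡ (y * x)
    *-identityʳ : ∀ x → (x * 1#) ≡ x
    resid₁ : ∀ x y z → (z * x) ≤ y → z ≤ (x ⇛ y)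
    resid₂ : ∀ x y z → z ≤ (x ⇛ y) → (z * x) ≤ y
    prelinear : ∀ x y → ((x ⇛ y) ⊔ (y ⇛ x)) ≡ 1#
    divisibility : ∀ x y → (x ⊓ y) ≡ (x * (x ⇛ y))
    involution   : ∀ x → ((x ⇛ 0#) ⇛ 0#) ≡ x

  ∼_ : Carrier → Carrier
  ∼ x = x ⇛ 0#

  _<_ : Carrier → Carrier → Set
  x < y = x ≤ y × ¬ (x ≡ y)

  Pos : Carrier → Set
  Pos x = (∼ x) < x

opsOf : MVChain → ChainOps
opsOf 𝒜 = record
  { Carrier = Carrier ; _*_ = _*_ ; _⇛_ = _⇛_ ; _⊓_ = _⊓_ ; _⊔_ = _⊔_
  ; 0# = 0# ; 1# = 1# }
  where open MVChain 𝒜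

twoOps : ChainOps
twoOps = record
  { Carrier = Bool ; _*_ = B._∧_ ; _⇛_ = λ x y → not x B.∨ y
  ; _⊓_ = B._∧_ ; _⊔_ = B._∨_ ; 0# = false ; 1# = true }

infixr 6 _&_ _∧'_
infixr 5 _⟶_

data Formula (ar : ℕ → ℕ) : Set where
  atom : (P : ℕ) → Vec ℕ (ar P) → Formula ar
  _&_ _⟶_ _∧'_ : Formula ar → Formula ar → Formula ar
  ⊥' : Formula ar
  ∀' ∃' : ℕ → Formula ar → Formula ar

module _ {ar : ℕ → ℕ} where

  infixr 6 _∨'_
  infixr 5 _↔'_

  ¬' : Formula ar → Formula ar
  ¬' φ = φ ⟶ ⊥'

  ⊤' : Formula ar
  ⊤' = ⊥' ⟶ ⊥'

  -- standard MTL definition of disjunction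
  _∨'_ : Formula ar → Formula ar → Formula ar
  φ ∨' ψ = ((φ ⟶ ψ) ⟶ ψ) ∧' ((ψ ⟶ φ) ⟶ φ)

  _↔'_ : Formula ar → Formula ar → Formula ar
  φ ↔' ψ = (φ ⟶ ψ) ∧' (ψ ⟶ φ)

  data Classical : Formula ar → Set where
    c-atom : ∀ P xs → Classical (atom P xs)
    c-and  : ∀ {φ ψ} → Classical φ → Classical ψ → Classical (φ ∧' ψ)
    c-or   : ∀ {φ ψ} → Classical φ → Classical ψ → Classical (φ ∨' ψ)
    c-neg  : ∀ {φ} → Classical φ → Classical (¬' φ)
    c-all  : ∀ {φ} x → Classical φ → Classical (∀' x φ)

  AtomOcc : Set
  AtomOcc = Σ ℕ (λ P → Vec ℕ (ar P))

  atoms : Formula ar → List AtomOcc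
  atoms (atom P xs) = (P , xs) ∷ []
  atoms (φ & ψ)  = atoms φ ++ atoms ψ
  atoms (φ ⟶ ψ)  = atoms φ ++ atoms ψ
  atoms (φ ∧' ψ) = atoms φ ++ atoms ψ
  atoms ⊥'       = []
  atoms (∀' x φ) = atoms φ
  atoms (∃' x φ) = atoms φ

  closeAll : ∀ {k} → Vec ℕ k → Formula ar → Formula ar
  closeAll []       φ = φ
  closeAll (x ∷ xs) φ = ∀' x (closeAll xs φ)

  predefAtom : AtomOcc → Formula ar
  predefAtom (P , xs) = closeAll xs (¬' (atom P xs ↔' ¬' (atom P xs)))

  bigAnd : List (Formula ar) → Formula ar
  bigAnd []           = ⊤'
  bigAnd (φ ∷ [])     = φ
  bigAnd (φ ∷ ψ ∷ l)  = φ ∧' bigAnd (ψ ∷ l)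

  PREDEF : Formula ar → Formula ar
  PREDEF φ = bigAnd (List.map predefAtom (atoms φ))

record Model (ar : ℕ → ℕ) (C : ChainOps) (n : ℕ) : Set where
  field
    rel : (P : ℕ) → Vec (Fin (suc n)) (ar P) → ChainOps.Carrier C

Eval : ℕ → Set
Eval n = ℕ → Fin (suc n)

_[_↦_] : ∀ {n} → Eval n → ℕ → Fin (suc n) → Eval n
(v [ x ↦ a ]) y = if x ≡ᵇ y then a else v y

module Semantics (C : ChainOps) where
  open ChainOps C

  bigMeet : ∀ {n} → (Fin (suc n) → Carrier) → Carrier
  bigMeet {zero}  f = f zero
  bigMeet {suc n} f = f zero ⊓ bigMeet (λ i → f (suc i))

  bigJoin : ∀ {n} → (Fin (suc n) → Carrier) → Carrier
  bigJoin {zero}  f = f zero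
  bigJoin {suc n} f = f zero ⊔ bigJoin (λ i → f (suc i))

  eval : ∀ {ar n} → Model ar C n → Eval n → Formula ar → Carrier
  eval M v (atom P xs) = Model.rel M P (Vec.map v xs)
  eval M v (φ & ψ)  = eval M v φ * eval M v ψ
  eval M v (φ ⟶ ψ)  = eval M v φ ⇛ eval M v ψ
  eval M v (φ ∧' ψ) = eval M v φ ⊓ eval M v ψ
  eval M v ⊥'       = 0#
  eval M v (∀' x φ) = bigMeet (λ a → eval M (v [ x ↦ a ]) φ)
  eval M v (∃' x φ) = bigJoin (λ a → eval M (v [ x ↦ a ]) φ)

evalIn : ∀ (C : ChainOps) {ar n} → Model ar C n → Eval n → Formula ar → ChainOps.Carrier C
evalIn C = Semantics.eval C

module Submission where

open import Defs
open import Data.Nat using (ℕ; _≡ᵇ_)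
open import Data.Nat.Properties using (≡ᵇ⇒≡; ≡⇒≡ᵇ)
open import Data.Bool using (Bool; true; false; not; _∧_; _∨_; b≤b; f≤t)
import Data.Bool as Bool
open import Data.Bool.Properties using (∧-comm; ∨-comm; ∧-idem; ∨-idem; ∨-identityʳ)
open import Data.Fin using (Fin; zero; suc)
open import Data.Vec using (Vec; []; _∷_)
import Data.Vec as Vec
open import Data.List using (List; []; _∷_)
import Data.List as List
open import Data.List.Relation.Unary.All as All using (All; []; _∷_)
open import Data.List.Relation.Unary.All.Properties using (map⁻; ++⁻ˡ; ++⁻ʳ)
open import Data.Product using (_,_)
open import Data.Sum using (inj₁; inj₂)
open import Data.Empty using (⊥-elim)
open import Function using (_∘_)
open import Function.Bundles using (_⇔_; mk⇔; Equivalence)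
open import Relation.Nullary using (¬_)
open import Relation.Binary.PropositionalEquality
  using (_≡_; refl; sym; trans; cong; cong₂; subst; subst₂; module ≡-Reasoning)

-- Since ∼ is an order-reversing involution of the chain, every element a
-- that is not a fixpoint of ∼ lies strictly on one side of it: either a ∈ A⁺
-- or a < ∼a; call this Boolean the sign of a. Positivity of PREDEF_φ forces
-- every instance of an atom of φ away from the fixpoint, so atoms have signs,
-- and by hypothesis these are their values in M'. Signs then propagate through
-- classical formulas exactly like 2-values: ∼ flips the sign, and as the order
-- is linear, ⊓ and the MTL disjunction (which computes max) return one of their
-- arguments, whose sign is the Boolean meet, resp. join, of the two signs; ∀
-- is an iterated ⊓. Hence ‖φ‖ has sign ‖φ‖₂, which is the claim.

∧-of-≤ : ∀ {b c} → b Bool.≤ c → b ∧ c ≡ b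
∧-of-≤ {b} b≤b = ∧-idem b
∧-of-≤ f≤t     = refl

∨-of-≤ : ∀ {b c} → b Bool.≤ c → b ∨ c ≡ c
∨-of-≤ {b} b≤b = ∨-idem b
∨-of-≤ f≤t     = refl

∨-via-⇒ : ∀ b c → ((not (not b ∨ c) ∨ c) ∧ (not (not c ∨ b) ∨ b)) ≡ b ∨ c
∨-via-⇒ false false = refl
∨-via-⇒ false true  = refl
∨-via-⇒ true  false = refl
∨-via-⇒ true  true  = refl

module MVChainProperties (𝒜 : MVChain) where
  open MVChain 𝒜

  private variable
    x y z a : Carrier
    b c : Bool

  ≤-reflexive : x ≡ y → x ≤ y
  ≤-reflexive {x} refl = ≤-refl x

  <-≤-trans : x < y → y ≤ z → x < z
  <-≤-trans (x≤y , x≢y) y≤z =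
    ≤-trans x≤y y≤z , λ x≡z → x≢y (≤-antisym x≤y (subst (_ ≤_) (sym x≡z) y≤z))

  ≤-<-trans : x ≤ y → y < z → x < z
  ≤-<-trans x≤y (y≤z , y≢z) =
    ≤-trans x≤y y≤z , λ x≡z → y≢z (≤-antisym y≤z (subst (_≤ _) x≡z x≤y))

  <-asym : x < y → ¬ y < x
  <-asym (x≤y , x≢y) (y≤x , _) = x≢y (≤-antisym x≤y y≤x)

  0<-mono : 0# < x → x ≤ y → 0# < y
  0<-mono {x} {y} (_ , 0≢x) x≤y =
    0-least y , λ 0≡y → 0≢x (≤-antisym (0-least x) (subst (x ≤_) (sym 0≡y) x≤y))

  ⊓-comm : ∀ x y → x ⊓ y ≡ y ⊓ x
  ⊓-comm x y = ≤-antisym (⊓-glb (⊓-lowerʳ x y) (⊓-lowerˡ x y))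
                         (⊓-glb (⊓-lowerʳ y x) (⊓-lowerˡ y x))

  x≤y⇒x⊓y≡x : x ≤ y → x ⊓ y ≡ x
  x≤y⇒x⊓y≡x {x} {y} x≤y = ≤-antisym (⊓-lowerˡ x y) (⊓-glb (≤-refl x) x≤y)

  *-identityˡ : ∀ x → 1# * x ≡ x
  *-identityˡ x = trans (*-comm 1# x) (*-identityʳ x)

  *-monoˡ-≤ : ∀ z → x ≤ y → x * z ≤ y * z
  *-monoˡ-≤ {x} {y} z x≤y =
    resid₂ z (y * z) x (≤-trans x≤y (resid₁ z (y * z) y (≤-refl (y * z))))

  ∼-antitone : x ≤ y → ∼ y ≤ ∼ x
  ∼-antitone {x} {y} x≤y = resid₁ x 0# (∼ y)
    (≤-trans (≤-reflexive (*-comm (∼ y) x))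
    (≤-trans (*-monoˡ-≤ (∼ y) x≤y)
    (≤-trans (≤-reflexive (*-comm y (∼ y)))
             (resid₂ y 0# (∼ y) (≤-refl (∼ y))))))

  x≤y⇒x⇛y≡1 : x ≤ y → x ⇛ y ≡ 1#
  x≤y⇒x⇛y≡1 {x} {y} x≤y =
    ≤-antisym (1-great _) (resid₁ x y 1# (subst (_≤ y) (sym (*-identityˡ x)) x≤y))

  1⇛y≡y : ∀ y → 1# ⇛ y ≡ y
  1⇛y≡y y = ≤-antisym
    (subst (_≤ y) (*-identityʳ _) (resid₂ 1# y (1# ⇛ y) (≤-refl _)))
    (resid₁ 1# y y (≤-reflexive (*-identityʳ y)))

  y≤[y⇛x]⇛x : ∀ y x → y ≤ (y ⇛ x) ⇛ x
  y≤[y⇛x]⇛x y x = resid₁ (y ⇛ x) x y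
    (subst (_≤ x) (*-comm (y ⇛ x) y) (resid₂ y x (y ⇛ x) (≤-refl _)))

  _⊻_ : Carrier → Carrier → Carrier
  x ⊻ y = ((x ⇛ y) ⇛ y) ⊓ ((y ⇛ x) ⇛ x)

  ⊻-comm : ∀ x y → x ⊻ y ≡ y ⊻ x
  ⊻-comm x y = ⊓-comm _ _

  x≤y⇒x⊻y≡y : x ≤ y → x ⊻ y ≡ y
  x≤y⇒x⊻y≡y {x} {y} x≤y = begin
    ((x ⇛ y) ⇛ y) ⊓ ((y ⇛ x) ⇛ x) ≡⟨ cong (λ u → (u ⇛ y) ⊓ ((y ⇛ x) ⇛ x)) (x≤y⇒x⇛y≡1 x≤y) ⟩
    (1# ⇛ y) ⊓ ((y ⇛ x) ⇛ x)      ≡⟨ cong (_⊓ ((y ⇛ x) ⇛ x)) (1⇛y≡y y) ⟩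
    y ⊓ ((y ⇛ x) ⇛ x)             ≡⟨ x≤y⇒x⊓y≡x (y≤[y⇛x]⇛x y x) ⟩
    y                             ∎
    where open ≡-Reasoning

  bigMeet-lower : ∀ {n} (f : Fin (ℕ.suc n) → Carrier) i → Semantics.bigMeet (opsOf 𝒜) f ≤ f i
  bigMeet-lower {ℕ.zero}  f zero    = ≤-refl (f zero)
  bigMeet-lower {ℕ.suc n} f zero    = ⊓-lowerˡ _ _
  bigMeet-lower {ℕ.suc n} f (suc i) = ≤-trans (⊓-lowerʳ _ _) (bigMeet-lower (f ∘ suc) i)

  0<∼[a↔∼a]⇒a≢∼a : 0# < (∼ ((a ⇛ (∼ a)) ⊓ ((∼ a) ⇛ a))) → ¬ a ≡ ∼ a
  0<∼[a↔∼a]⇒a≢∼a {a} (_ , 0≢) a≡∼a = 0≢ (sym (begin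
    ∼ ((a ⇛ (∼ a)) ⊓ ((∼ a) ⇛ a)) ≡⟨ cong₂ (λ u w → ∼ (u ⊓ w)) (x≤y⇒x⇛y≡1 (≤-reflexive a≡∼a))
                                                          (x≤y⇒x⇛y≡1 (≤-reflexive (sym a≡∼a))) ⟩
    ∼ (1# ⊓ 1#)               ≡⟨ cong ∼_ (x≤y⇒x⊓y≡x (≤-refl 1#)) ⟩
    ∼ 1#                      ≡⟨ 1⇛y≡y 0# ⟩
    0#                        ∎))
    where open ≡-Reasoning

  Neg : Carrier → Set
  Neg x = x < (∼ x)

  HasSign : Carrier → Bool → Set
  HasSign x true  = Pos x
  HasSign x false = Neg x

  Pos≰Neg : Pos x → Neg y → ¬ x ≤ y
  Pos≰Neg px ny x≤y = <-asym ny (≤-<-trans (∼-antitone x≤y) (<-≤-trans px x≤y))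

  HasSign-monotone : x ≤ y → HasSign x b → HasSign y c → b Bool.≤ c
  HasSign-monotone {b = false} {c = false} _   _  _  = b≤b
  HasSign-monotone {b = false} {c = true}  _   _  _  = f≤t
  HasSign-monotone {b = true}  {c = true}  _   _  _  = b≤b
  HasSign-monotone {b = true}  {c = false} x≤y px ny = ⊥-elim (Pos≰Neg px ny x≤y)

  HasSign-by-totality : (_∙_ : Carrier → Carrier → Carrier) (_∙ᵇ_ : Bool → Bool → Bool) →
    (∀ x y → x ∙ y ≡ y ∙ x) → (∀ b c → b ∙ᵇ c ≡ c ∙ᵇ b) →
    (∀ {x y b c} → x ≤ y → HasSign x b → HasSign y c → HasSign (x ∙ y) (b ∙ᵇ c)) →
    HasSign x b → HasSign y c → HasSign (x ∙ y) (b ∙ᵇ c)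
  HasSign-by-totality {x} {b} {y} {c} _∙_ _∙ᵇ_ comm commᵇ ordered sx sy with ≤-total x y
  ... | inj₁ x≤y = ordered x≤y sx sy
  ... | inj₂ y≤x = subst₂ HasSign (comm y x) (commᵇ c b) (ordered y≤x sy sx)

  HasSign-⊓ : HasSign x b → HasSign y c → HasSign (x ⊓ y) (b ∧ c)
  HasSign-⊓ = HasSign-by-totality _⊓_ _∧_ ⊓-comm ∧-comm λ x≤y sx sy →
    subst₂ HasSign (sym (x≤y⇒x⊓y≡x x≤y)) (sym (∧-of-≤ (HasSign-monotone x≤y sx sy))) sx

  HasSign-⊻ : HasSign x b → HasSign y c → HasSign (x ⊻ y) (b ∨ c)
  HasSign-⊻ = HasSign-by-totality _⊻_ _∨_ ⊻-comm ∨-comm λ x≤y sx sy →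
    subst₂ HasSign (sym (x≤y⇒x⊻y≡y x≤y)) (sym (∨-of-≤ (HasSign-monotone x≤y sx sy))) sy

  HasSign-∼ : HasSign x b → HasSign (∼ x) (not b)
  HasSign-∼ {x} {true}  px = subst ((∼ x) <_) (sym (involution x)) px
  HasSign-∼ {x} {false} nx = subst (_< (∼ x)) (sym (involution x)) nx

  HasSign-bigMeet : ∀ {n} {f : Fin (ℕ.suc n) → Carrier} {g : Fin (ℕ.suc n) → Bool} →
    (∀ i → HasSign (f i) (g i)) →
    HasSign (Semantics.bigMeet (opsOf 𝒜) f) (Semantics.bigMeet twoOps g)
  HasSign-bigMeet {ℕ.zero}  s = s zero
  HasSign-bigMeet {ℕ.suc n} s = HasSign-⊓ (s zero) (HasSign-bigMeet (s ∘ suc))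

  HasSign-of-⇔Pos : ¬ a ≡ ∼ a → (b ≡ true ⇔ Pos a) → HasSign a b
  HasSign-of-⇔Pos {b = true} _ b⇔pos = Equivalence.to b⇔pos refl
  HasSign-of-⇔Pos {a} {b = false} a≢∼a b⇔pos with ≤-total a (∼ a)
  ... | inj₁ a≤∼a = a≤∼a , a≢∼a
  ... | inj₂ ∼a≤a with Equivalence.from b⇔pos (∼a≤a , a≢∼a ∘ sym)
  ...   | ()

  HasSign⇒Pos⇔true : HasSign x b → Pos x ⇔ b ≡ true
  HasSign⇒Pos⇔true {b = true}  px = mk⇔ (λ _ → refl) (λ _ → px)
  HasSign⇒Pos⇔true {b = false} nx = mk⇔ (λ px → ⊥-elim (<-asym nx px)) λ ()

module _ {n : ℕ} where

  update-self : ∀ (u : Eval n) x a → (u [ x ↦ a ]) x ≡ a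
  update-self u x a with x ≡ᵇ x | ≡⇒≡ᵇ x x refl
  ... | true | _ = refl

  update-agrees : ∀ (u t : Eval n) x y → u y ≡ t y → (u [ x ↦ t x ]) y ≡ t y
  update-agrees u t x y uy≡ty with x ≡ᵇ y | ≡ᵇ⇒≡ x y
  ... | true  | x≡y = cong t (x≡y _)
  ... | false | _   = uy≡ty

  _[_≔_] : ∀ {k} → Eval n → Vec ℕ k → Eval n → Eval n
  u [ []     ≔ t ] = u
  u [ x ∷ xs ≔ t ] = (u [ x ↦ t x ]) [ xs ≔ t ]

  ≔-agrees : ∀ {k} (u t : Eval n) (xs : Vec ℕ k) y → u y ≡ t y → (u [ xs ≔ t ]) y ≡ t y
  ≔-agrees u t []       y uy≡ty = uy≡ty
  ≔-agrees u t (x ∷ xs) y uy≡ty = ≔-agrees _ t xs y (update-agrees u t x y uy≡ty)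

  map-≔ : ∀ {k} (u t : Eval n) (xs : Vec ℕ k) → Vec.map (u [ xs ≔ t ]) xs ≡ Vec.map t xs
  map-≔ u t []       = refl
  map-≔ u t (x ∷ xs) =
    cong₂ _∷_ (≔-agrees _ t xs x (update-self u x (t x))) (map-≔ (u [ x ↦ t x ]) t xs)

module SignTransfer {ar : ℕ → ℕ} (𝒜 : MVChain) {n : ℕ}
    (M : Model ar (opsOf 𝒜) n) (M' : Model ar twoOps n) where
  open MVChain 𝒜
  open MVChainProperties 𝒜

  infix 30 ‖_‖_ ‖_‖₂_

  ‖_‖_ : Formula ar → Eval n → Carrier
  ‖ φ ‖ v = evalIn (opsOf 𝒜) M v φ

  ‖_‖₂_ : Formula ar → Eval n → Bool
  ‖ φ ‖₂ v = evalIn twoOps M' v φ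

  Predefined : AtomOcc {ar} → Set
  Predefined (P , xs) = ∀ w → ¬ Model.rel M P (Vec.map w xs) ≡ ∼ Model.rel M P (Vec.map w xs)

  0<bigAnd⇒0<all : ∀ v (ψs : List (Formula ar)) →
    0# < ‖ bigAnd ψs ‖ v → All (λ ψ → 0# < ‖ ψ ‖ v) ψs
  0<bigAnd⇒0<all v []           _ = []
  0<bigAnd⇒0<all v (ψ ∷ [])     h = h ∷ []
  0<bigAnd⇒0<all v (ψ ∷ ψ′ ∷ ψs) h =
    0<-mono h (⊓-lowerˡ _ _) ∷ 0<bigAnd⇒0<all v (ψ′ ∷ ψs) (0<-mono h (⊓-lowerʳ _ _))

  0<closeAll⇒0<≔ : ∀ {k} (xs : Vec ℕ k) ψ u t →
    0# < ‖ closeAll xs ψ ‖ u → 0# < ‖ ψ ‖ (u [ xs ≔ t ])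
  0<closeAll⇒0<≔ []       ψ u t h = h
  0<closeAll⇒0<≔ (x ∷ xs) ψ u t h = 0<closeAll⇒0<≔ xs ψ (u [ x ↦ t x ]) t
    (0<-mono h (bigMeet-lower (λ a → ‖ closeAll xs ψ ‖ (u [ x ↦ a ])) (t x)))

  -- The closure is instantiated at v [ xs ≔ w ], which sees the atom as at w.
  0<predefAtom⇒Predefined : ∀ v o → 0# < ‖ predefAtom o ‖ v → Predefined o
  0<predefAtom⇒Predefined v (P , xs) h w =
    subst (λ ws → ¬ Model.rel M P ws ≡ ∼ Model.rel M P ws) (map-≔ v w xs)
      (0<∼[a↔∼a]⇒a≢∼a (0<closeAll⇒0<≔ xs _ v w h))

  0<PREDEF⇒Predefined : ∀ φ v → 0# < ‖ PREDEF φ ‖ v → All Predefined (atoms φ)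
  0<PREDEF⇒Predefined φ v h =
    All.map (0<predefAtom⇒Predefined v _) (map⁻ (0<bigAnd⇒0<all v _ h))

  HasSign-classical :
    (∀ P xs v → (‖ atom P xs ‖₂ v ≡ true) ⇔ Pos (‖ atom P xs ‖ v)) →
    ∀ {φ} → Classical φ → All Predefined (atoms φ) → ∀ v → HasSign (‖ φ ‖ v) (‖ φ ‖₂ v)
  HasSign-classical atoms-agree = sign
    where
    sign : ∀ {φ} → Classical φ → All Predefined (atoms φ) → ∀ v → HasSign (‖ φ ‖ v) (‖ φ ‖₂ v)
    sign (c-atom P xs) (pd ∷ []) v = HasSign-of-⇔Pos (pd v) (atoms-agree P xs v)
    sign (c-and {φ} cφ cψ) pd v =
      HasSign-⊓ (sign cφ (++⁻ˡ (atoms φ) pd) v) (sign cψ (++⁻ʳ (atoms φ) pd) v)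
    sign (c-or {φ} {ψ} cφ cψ) pd v =
      subst (HasSign _) (sym (∨-via-⇒ (‖ φ ‖₂ v) (‖ ψ ‖₂ v)))
        (HasSign-⊻ (sign cφ (++⁻ˡ (atoms φ) pdφ⇒ψ) v) (sign cψ (++⁻ʳ (atoms φ) pdφ⇒ψ) v))
      where pdφ⇒ψ = ++⁻ˡ (atoms φ List.++ atoms ψ) (++⁻ˡ _ pd)
    sign (c-neg {φ} cφ) pd v =
      subst (HasSign _) (sym (∨-identityʳ (not (‖ φ ‖₂ v))))
        (HasSign-∼ (sign cφ (++⁻ˡ (atoms φ) pd) v))
    sign (c-all x cφ) pd v = HasSign-bigMeet (λ a → sign cφ pd (v [ x ↦ a ]))

mainTheorem10 : (ar : ℕ → ℕ) (𝒜 : MVChain) (n : ℕ)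
    (M : Model ar (opsOf 𝒜) n) (M' : Model ar twoOps n) →
    (∀ (P : ℕ) (xs : Vec ℕ (ar P)) (v : Eval n) →
      (evalIn twoOps M' v (atom P xs) ≡ true)
        ⇔ MVChain.Pos 𝒜 (evalIn (opsOf 𝒜) M v (atom P xs))) →
    ∀ (φ : Formula ar) → Classical φ → ∀ (v : Eval n) →
    MVChain._<_ 𝒜 (MVChain.0# 𝒜) (evalIn (opsOf 𝒜) M v (PREDEF φ)) →
    MVChain.Pos 𝒜 (evalIn (opsOf 𝒜) M v φ) ⇔ (evalIn twoOps M' v φ ≡ true)
mainTheorem10 ar 𝒜 n M M' atoms-agree φ classical v 0<predef =
  HasSign⇒Pos⇔true
    (HasSign-classical atoms-agree classical (0<PREDEF⇒Predefined φ v 0<predef) v)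
  where
  open MVChainProperties 𝒜
  open SignTransfer 𝒜 M M'
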